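{- Let $a\ge2$ be an integer and let $w(t)=\frac{1}{2^a}(t-1)+1$. Let $z$ be the number whose binary expansion is the concatenation $[w(1)]_2\,[w(2)]_2\,[w(3)]_2\cdots$. Then $z$ is exceptional: $\frac{L_n(z)}{\log_2 n}$ does not converge to $1$.
   Context: $[w(k)]_2$ denotes the binary notation of the integer part of $w(k)$. Equivalently, the expansion of $z$ consists of the binary notation of each positive integer $j=1,2,3,\dots$, written $2^a$ times consecutively. For a binary sequence $x$, $L_n(x)$ is the length of the longest run of consecutive ones among its first $n$ digits. A number is exceptional if it is not typical, i.e. if $L_n(x)/\log_2 n\not\to 1$. -}

module Defs where

open import Data.Nat using (ℕ; zero; suc; _+_; _*_; _∸_; _^_; _≤_; _⊔_)
open import Data.Nat.DivMod using (_/_; _%_)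
open import Data.Nat.Properties using (m^n≢0)
open import Data.Bool using (Bool; true; false)
open import Data.List using (List; []; _∷_; reverse; concat; map; take; upTo)
open import Data.Product using (Σ; ∃; _×_)
open import Relation.Nullary using (¬_)

-- Least-significant-first binary digits of m, with fuel f (fuel m suffices).
-- true = digit 1, false = digit 0.
bitsRevFuel : ℕ → ℕ → List Bool
bitsRevFuel zero    _       = []
bitsRevFuel (suc f) zero    = []
bitsRevFuel (suc f) (suc m) with (suc m) % 2
... | zero  = false ∷ bitsRevFuel f (suc m / 2)
... | suc _ = true  ∷ bitsRevFuel f (suc m / 2)

bin : ℕ → List Bool
bin m = reverse (bitsRevFuel m m)

w : ℕ → ℕ → ℕ
w a k = _/_ (k ∸ 1) (2 ^ a) {{m^n≢0 2 a}} + 1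

zPrefixBlocks : ℕ → ℕ → List Bool
zPrefixBlocks a K = concat (map (λ i → bin (w a (suc i))) (upTo K))

-- First n binary digits of z (each block has ≥ 1 digit, so n blocks suffice).
zDigits : ℕ → ℕ → List Bool
zDigits a n = take n (zPrefixBlocks a n)

runGo : ℕ → ℕ → List Bool → ℕ
runGo cur best []           = best
runGo cur best (true ∷ xs)  = runGo (suc cur) (best ⊔ suc cur) xs
runGo cur best (false ∷ xs) = runGo zero best xs

longestRun : List Bool → ℕ
longestRun = runGo zero zero

L : ℕ → ℕ → ℕ
L a n = longestRun (zDigits a n)

-- "L_n / log₂ n → 1", stated without reals: for every ε = 1/(k+1) there is N
-- such that for all n ≥ N,  (1 - ε) log₂ n ≤ L_n ≤ (1 + ε) log₂ n,
-- i.e. (multiplying by k+1 and exponentiating base 2)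
--   n^k ≤ 2^((k+1) L_n) ≤ n^(k+2).
ConvergesToOne : (ℕ → ℕ) → Set
ConvergesToOne Ln =
  ∀ (k : ℕ) → ∃ λ (N : ℕ) → ∀ (n : ℕ) → N ≤ n →
    (n ^ k ≤ 2 ^ (suc k * Ln n)) × (2 ^ (suc k * Ln n) ≤ n ^ (suc (suc k)))

Exceptional : (ℕ → ℕ) → Set
Exceptional Ln = ¬ ConvergesToOne Ln

{-# OPTIONS --safe #-}
module Submission where

-- The number 2^m − 1 is written as m ones, and w takes each value on 2^a
-- consecutive indices, so z contains a run of 2^a·m ones ending at a position
-- n < 2^m · 2^a · m.  Taking m = 2^y with y ≥ a gives log₂ n < 2m, hence
-- L_n ≥ 2^a·m ≥ 4m > 2 log₂ n infinitely often, which rules out L_n ≤ 2 log₂ n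
-- for all large n (the upper half of the case ε = 1 of convergence to 1).

open import Defs
open import Data.Nat using (ℕ; zero; suc; _≤_; _+_; _*_; _∸_; _^_; _<_; _⊔_; z≤n; s≤s; NonZero)
open import Data.Nat.Properties
open import Data.Nat.Tactic.RingSolver using (solve-∀)
open import Data.Nat.DivMod using (_/_; _%_; [m+kn]%n≡m%n; m*n/n≡m; m<n⇒m/n≡0; +-distrib-/-∣ʳ; m<n*o⇒m/o<n)
open import Data.Nat.Divisibility using (n∣m*n)
open import Data.Bool using (Bool; true; false)
open import Data.List using (List; []; _∷_; _++_; _∷ʳ_; reverse; concat; take; applyUpTo; length; replicate)
open import Data.List.Properties using (++-assoc; length-++; length-reverse; unfold-reverse; map-upTo)
open import Data.Product using (∃; _×_; _,_; proj₂)
open import Function using (_∘_)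
open import Relation.Binary.PropositionalEquality using (_≡_; refl; sym; trans; cong; cong₂; subst; module ≡-Reasoning)

private
  variable
    A : Set

runGo-mono : ∀ {c c′ b b′} xs → c ≤ c′ → b ≤ b′ → runGo c b xs ≤ runGo c′ b′ xs
runGo-mono []           c≤c′ b≤b′ = b≤b′
runGo-mono (true ∷ xs)  c≤c′ b≤b′ = runGo-mono xs (s≤s c≤c′) (⊔-mono-≤ b≤b′ (s≤s c≤c′))
runGo-mono (false ∷ xs) c≤c′ b≤b′ = runGo-mono xs ≤-refl b≤b′

longestRun-++ʳ : ∀ xs ys → longestRun ys ≤ longestRun (xs ++ ys)
longestRun-++ʳ xs ys = go xs 0 0
  where
  go : ∀ xs c b → runGo 0 0 ys ≤ runGo c b (xs ++ ys)
  go []           c b = runGo-mono ys z≤n z≤n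
  go (true ∷ xs)  c b = go xs (suc c) (b ⊔ suc c)
  go (false ∷ xs) c b = go xs zero b

longestRun-replicate : ∀ r → r ≤ longestRun (replicate r true)
longestRun-replicate r = go r 0 0 z≤n
  where
  go : ∀ r c b → c ≤ b → c + r ≤ runGo c b (replicate r true)
  go zero    c b c≤b = ≤-trans (≤-reflexive (+-identityʳ c)) c≤b
  go (suc r) c b c≤b = ≤-trans (≤-reflexive (+-suc c r)) (go r (suc c) (b ⊔ suc c) (m≤n⊔m b (suc c)))

replicate-++ : ∀ m n {x : A} → replicate m x ++ replicate n x ≡ replicate (m + n) x
replicate-++ zero    n = refl
replicate-++ (suc m) n = cong (_ ∷_) (replicate-++ m n)

reverse-replicate : ∀ n (x : A) → reverse (replicate n x) ≡ replicate n x
reverse-replicate zero    x = refl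
reverse-replicate (suc n) x = begin
  reverse (x ∷ replicate n x)      ≡⟨ unfold-reverse x (replicate n x) ⟩
  reverse (replicate n x) ∷ʳ x     ≡⟨ cong (_∷ʳ x) (reverse-replicate n x) ⟩
  replicate n x ++ replicate 1 x   ≡⟨ replicate-++ n 1 ⟩
  replicate (n + 1) x              ≡⟨ cong (λ k → replicate k x) (+-comm n 1) ⟩
  replicate (suc n) x              ∎
  where open ≡-Reasoning

take-length-++ : ∀ (xs ys : List A) → take (length xs) (xs ++ ys) ≡ xs
take-length-++ []       ys = refl
take-length-++ (x ∷ xs) ys = cong (x ∷_) (take-length-++ xs ys)

concat-applyUpTo-+ : ∀ (F : ℕ → List A) m n →
  concat (applyUpTo F (m + n)) ≡ concat (applyUpTo F m) ++ concat (applyUpTo (F ∘ (m +_)) n)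
concat-applyUpTo-+ F zero    n = refl
concat-applyUpTo-+ F (suc m) n = trans
  (cong (F 0 ++_) (concat-applyUpTo-+ (F ∘ suc) m n))
  (sym (++-assoc (F 0) _ _))

length-concat-applyUpTo-≥ : ∀ (F : ℕ → List A) K → (∀ i → 1 ≤ length (F i)) →
  K ≤ length (concat (applyUpTo F K))
length-concat-applyUpTo-≥ F zero    nonempty = z≤n
length-concat-applyUpTo-≥ F (suc K) nonempty = ≤-trans
  (+-mono-≤ (nonempty 0) (length-concat-applyUpTo-≥ (F ∘ suc) K (nonempty ∘ suc)))
  (≤-reflexive (sym (length-++ (F 0))))

length-concat-applyUpTo-≤ : ∀ (F : ℕ → List A) K m → (∀ i → i < K → length (F i) ≤ m) →
  length (concat (applyUpTo F K)) ≤ K * m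
length-concat-applyUpTo-≤ F zero    m short = z≤n
length-concat-applyUpTo-≤ F (suc K) m short = ≤-trans
  (≤-reflexive (length-++ (F 0)))
  (+-mono-≤ (short 0 (s≤s z≤n)) (length-concat-applyUpTo-≤ (F ∘ suc) K m (λ i i<K → short (suc i) (s≤s i<K))))

concat-applyUpTo-replicate : ∀ (F : ℕ → List A) K m {x} → (∀ i → i < K → F i ≡ replicate m x) →
  concat (applyUpTo F K) ≡ replicate (K * m) x
concat-applyUpTo-replicate F zero    m constant = refl
concat-applyUpTo-replicate F (suc K) m constant = trans
  (cong₂ _++_ (constant 0 (s≤s z≤n))
              (concat-applyUpTo-replicate (F ∘ suc) K m (λ i i<K → constant (suc i) (s≤s i<K))))
  (replicate-++ m (K * m))

[m+kn]/n≡k : ∀ m k n .{{_ : NonZero n}} → m < n → (m + k * n) / n ≡ k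
[m+kn]/n≡k m k n m<n = begin
  (m + k * n) / n     ≡⟨ +-distrib-/-∣ʳ m (n∣m*n k) ⟩
  m / n + k * n / n   ≡⟨ cong₂ _+_ (m<n⇒m/n≡0 m<n) (m*n/n≡m k n) ⟩
  k                   ∎
  where open ≡-Reasoning

n+n≤2^n : ∀ n → n + n ≤ 2 ^ n
n+n≤2^n zero          = z≤n
n+n≤2^n (suc zero)    = ≤-refl
n+n≤2^n (suc (suc n)) = begin
  suc (suc n) + suc (suc n)   ≡⟨ cong suc (+-suc (suc n) (suc n)) ⟩
  2 + (suc n + suc n)         ≤⟨ +-mono-≤ (*-monoʳ-≤ 2 (m^n>0 2 n)) (n+n≤2^n (suc n)) ⟩
  2 ^ suc n + 2 ^ suc n       ≡⟨ cong (2 ^ suc n +_) (sym (+-identityʳ (2 ^ suc n))) ⟩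
  2 ^ suc (suc n)             ∎
  where open ≤-Reasoning

digit : ℕ → Bool
digit zero    = false
digit (suc _) = true

bitsRevFuel-suc : ∀ f x → bitsRevFuel (suc f) (suc x) ≡ digit (suc x % 2) ∷ bitsRevFuel f (suc x / 2)
bitsRevFuel-suc f x with suc x % 2
... | zero  = refl
... | suc _ = refl

0<length-bin : ∀ x → 0 < x → 0 < length (bin x)
0<length-bin (suc x) _ = begin
  1                                                        ≤⟨ s≤s z≤n ⟩
  length (digit (suc x % 2) ∷ bitsRevFuel x (suc x / 2))   ≡⟨ cong length (bitsRevFuel-suc x x) ⟨
  length (bitsRevFuel (suc x) (suc x))                     ≡⟨ length-reverse (bitsRevFuel (suc x) (suc x)) ⟨
  length (bin (suc x))                                     ∎
  where open ≤-Reasoning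

length-bin-< : ∀ x m → x < 2 ^ m → length (bin x) ≤ m
length-bin-< x m x<2^m = ≤-trans (≤-reflexive (length-reverse (bitsRevFuel x x))) (go x x m x<2^m)
  where
  go : ∀ f x m → x < 2 ^ m → length (bitsRevFuel f x) ≤ m
  go zero    x       m       _      = z≤n
  go (suc f) zero    m       _      = z≤n
  go (suc f) (suc x) zero    (s≤s ())
  go (suc f) (suc x) (suc m) x<2^m  = ≤-trans
    (≤-reflexive (cong length (bitsRevFuel-suc f x)))
    (s≤s (go f (suc x / 2) m (m<n*o⇒m/o<n (≤-trans x<2^m (≤-reflexive (*-comm 2 (2 ^ m)))))))

mersenne : ℕ → ℕ
mersenne zero    = 0
mersenne (suc m) = suc (mersenne m * 2)

suc-mersenne : ∀ m → suc (mersenne m) ≡ 2 ^ m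
suc-mersenne zero    = refl
suc-mersenne (suc m) = trans (cong (_* 2) (suc-mersenne m)) (*-comm (2 ^ m) 2)

m≤mersenne : ∀ m → m ≤ mersenne m
m≤mersenne zero    = z≤n
m≤mersenne (suc m) = s≤s (≤-trans (m≤mersenne m) (m≤m*n (mersenne m) 2))

bin-mersenne : ∀ m → bin (mersenne m) ≡ replicate m true
bin-mersenne m = trans (cong reverse (go m (mersenne m) (m≤mersenne m))) (reverse-replicate m true)
  where
  go : ∀ m f → m ≤ f → bitsRevFuel f (mersenne m) ≡ replicate m true
  go zero    zero    _         = refl
  go zero    (suc f) _         = refl
  go (suc m) (suc f) (s≤s m≤f) = begin
    bitsRevFuel (suc f) (1 + mersenne m * 2)
      ≡⟨ bitsRevFuel-suc f (mersenne m * 2) ⟩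
    digit ((1 + mersenne m * 2) % 2) ∷ bitsRevFuel f ((1 + mersenne m * 2) / 2)
      ≡⟨ cong₂ (λ r q → digit r ∷ bitsRevFuel f q)
               ([m+kn]%n≡m%n 1 (mersenne m) 2) ([m+kn]/n≡k 1 (mersenne m) 2 (s≤s (s≤s z≤n))) ⟩
    true ∷ bitsRevFuel f (mersenne m)
      ≡⟨ cong (true ∷_) (go m f m≤f) ⟩
    true ∷ replicate m true
      ∎
    where open ≡-Reasoning

block : ℕ → ℕ → List Bool
block a i = bin (w a (suc i))

zPrefixBlocks-applyUpTo : ∀ a K → zPrefixBlocks a K ≡ concat (applyUpTo (block a) K)
zPrefixBlocks-applyUpTo a K = cong concat (map-upTo (block a) K)

zPrefixBlocks-+ : ∀ a K j →
  zPrefixBlocks a (K + j) ≡ zPrefixBlocks a K ++ concat (applyUpTo (block a ∘ (K +_)) j)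
zPrefixBlocks-+ a K j = begin
  zPrefixBlocks a (K + j)
    ≡⟨ zPrefixBlocks-applyUpTo a (K + j) ⟩
  concat (applyUpTo (block a) (K + j))
    ≡⟨ concat-applyUpTo-+ (block a) K j ⟩
  concat (applyUpTo (block a) K) ++ concat (applyUpTo (block a ∘ (K +_)) j)
    ≡⟨ cong (_++ concat (applyUpTo (block a ∘ (K +_)) j)) (zPrefixBlocks-applyUpTo a K) ⟨
  zPrefixBlocks a K ++ concat (applyUpTo (block a ∘ (K +_)) j)
    ∎
  where open ≡-Reasoning

length-zPrefixBlocks-≥ : ∀ a K → K ≤ length (zPrefixBlocks a K)
length-zPrefixBlocks-≥ a K = subst (K ≤_)
  (cong length (sym (zPrefixBlocks-applyUpTo a K)))
  (length-concat-applyUpTo-≥ (block a) K (λ i → 0<length-bin (w a (suc i)) (m≤n+m 1 _)))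

length-zPrefixBlocks-≤ : ∀ a p m → p < 2 ^ m → length (zPrefixBlocks a (p * 2 ^ a)) ≤ p * 2 ^ a * m
length-zPrefixBlocks-≤ a p m p<2^m = subst (_≤ p * 2 ^ a * m)
  (cong length (sym (zPrefixBlocks-applyUpTo a (p * 2 ^ a))))
  (length-concat-applyUpTo-≤ (block a) (p * 2 ^ a) m
    (λ i i<K → length-bin-< (w a (suc i)) m (≤-<-trans (w≤p i i<K) p<2^m)))
  where
  w≤p : ∀ i → i < p * 2 ^ a → w a (suc i) ≤ p
  w≤p i i<K = ≤-trans (≤-reflexive (+-comm _ 1)) (m<n*o⇒m/o<n {{m^n≢0 2 a}} i<K)

w-constant : ∀ a q i → i < 2 ^ a → w a (suc (q * 2 ^ a + i)) ≡ suc q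
w-constant a q i i<2^a = begin
  (q * 2 ^ a + i) / 2 ^ a + 1   ≡⟨ cong (λ k → k / 2 ^ a + 1) (+-comm (q * 2 ^ a) i) ⟩
  (i + q * 2 ^ a) / 2 ^ a + 1   ≡⟨ cong (_+ 1) ([m+kn]/n≡k i q (2 ^ a) i<2^a) ⟩
  q + 1                         ≡⟨ +-comm q 1 ⟩
  suc q                         ∎
  where
  open ≡-Reasoning
  instance
    2^a≢0 : NonZero (2 ^ a)
    2^a≢0 = m^n≢0 2 a

L-length-zPrefixBlocks : ∀ a K → L a (length (zPrefixBlocks a K)) ≡ longestRun (zPrefixBlocks a K)
L-length-zPrefixBlocks a K = cong longestRun (begin
  take n (zPrefixBlocks a n)                 ≡⟨ cong (take n ∘ zPrefixBlocks a) (m+[n∸m]≡n K≤n) ⟨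
  take n (zPrefixBlocks a (K + (n ∸ K)))     ≡⟨ cong (take n) (zPrefixBlocks-+ a K (n ∸ K)) ⟩
  take n (zPrefixBlocks a K ++ _)            ≡⟨ take-length-++ (zPrefixBlocks a K) _ ⟩
  zPrefixBlocks a K                          ∎)
  where
  open ≡-Reasoning
  n : ℕ
  n = length (zPrefixBlocks a K)
  K≤n : K ≤ n
  K≤n = length-zPrefixBlocks-≥ a K

zPrefixBlocks-ends-with-ones : ∀ a q r → bin (suc q) ≡ replicate r true →
  zPrefixBlocks a (suc q * 2 ^ a) ≡ zPrefixBlocks a (q * 2 ^ a) ++ replicate (2 ^ a * r) true
zPrefixBlocks-ends-with-ones a q r bin≡ones = begin
  zPrefixBlocks a (2 ^ a + q * 2 ^ a)
    ≡⟨ cong (zPrefixBlocks a) (+-comm (2 ^ a) (q * 2 ^ a)) ⟩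
  zPrefixBlocks a (q * 2 ^ a + 2 ^ a)
    ≡⟨ zPrefixBlocks-+ a (q * 2 ^ a) (2 ^ a) ⟩
  zPrefixBlocks a (q * 2 ^ a) ++ concat (applyUpTo (block a ∘ (q * 2 ^ a +_)) (2 ^ a))
    ≡⟨ cong (zPrefixBlocks a (q * 2 ^ a) ++_) (concat-applyUpTo-replicate _ (2 ^ a) r
         (λ i i<2^a → trans (cong bin (w-constant a q i i<2^a)) bin≡ones)) ⟩
  zPrefixBlocks a (q * 2 ^ a) ++ replicate (2 ^ a * r) true
    ∎
  where open ≡-Reasoning

longestRun-zPrefixBlocks-≥ : ∀ a p r → bin p ≡ replicate r true →
  2 ^ a * r ≤ longestRun (zPrefixBlocks a (p * 2 ^ a))
longestRun-zPrefixBlocks-≥ a zero    zero    _         = ≤-trans (≤-reflexive (*-zeroʳ (2 ^ a))) z≤n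
longestRun-zPrefixBlocks-≥ a zero    (suc r) ()
longestRun-zPrefixBlocks-≥ a (suc q) r       bin≡ones = begin
  2 ^ a * r
    ≤⟨ longestRun-replicate (2 ^ a * r) ⟩
  longestRun (replicate (2 ^ a * r) true)
    ≤⟨ longestRun-++ʳ (zPrefixBlocks a (q * 2 ^ a)) _ ⟩
  longestRun (zPrefixBlocks a (q * 2 ^ a) ++ replicate (2 ^ a * r) true)
    ≡⟨ cong longestRun (zPrefixBlocks-ends-with-ones a q r bin≡ones) ⟨
  longestRun (zPrefixBlocks a (suc q * 2 ^ a))
    ∎
  where open ≤-Reasoning

exceptional-if-frequently-long : ∀ Ln → (∀ N → ∃ λ n → N ≤ n × n ^ 2 < 2 ^ Ln n) → Exceptional Ln
exceptional-if-frequently-long Ln frequently-long converges =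
  let N , bounded          = converges 0
      n , N≤n , n²<2^Ln[n] = frequently-long N
  in <⇒≱ n²<2^Ln[n] (subst (λ e → 2 ^ e ≤ n ^ 2) (*-identityˡ (Ln n)) (proj₂ (bounded n N≤n)))

frequently-long-runs : ∀ a → 2 ≤ a → ∀ N → ∃ λ n → N ≤ n × n ^ 2 < 2 ^ L a n
frequently-long-runs a 2≤a N = n , N≤n , n²<2^L[n]
  where
  y m p K n : ℕ
  y = a + N
  m = 2 ^ y
  p = mersenne m
  K = p * 2 ^ a
  n = length (zPrefixBlocks a K)

  long-run : 2 ^ a * m ≤ L a n
  long-run = subst (2 ^ a * m ≤_) (sym (L-length-zPrefixBlocks a K))
    (longestRun-zPrefixBlocks-≥ a p m (bin-mersenne m))

  open ≤-Reasoning

  N≤n : N ≤ n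
  N≤n = begin
    N      ≤⟨ m≤n+m N a ⟩
    y      ≤⟨ m≤m+n y y ⟩
    y + y  ≤⟨ n+n≤2^n y ⟩
    m      ≤⟨ m≤mersenne m ⟩
    p      ≤⟨ m≤m*n p (2 ^ a) {{m^n≢0 2 a}} ⟩
    K      ≤⟨ length-zPrefixBlocks-≥ a K ⟩
    n      ∎

  n<2^[m+m] : n < 2 ^ (m + m)
  n<2^[m+m] = begin-strict
    n                    ≤⟨ length-zPrefixBlocks-≤ a p m (≤-reflexive (suc-mersenne m)) ⟩
    p * 2 ^ a * m        ≡⟨ *-assoc p (2 ^ a) m ⟩
    p * (2 ^ a * 2 ^ y)  ≡⟨ cong (p *_) (^-distribˡ-+-* 2 a y) ⟨
    p * 2 ^ (a + y)      <⟨ *-monoˡ-< (2 ^ (a + y)) {{m^n≢0 2 (a + y)}} (≤-reflexive (suc-mersenne m)) ⟩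
    2 ^ m * 2 ^ (a + y)  ≤⟨ *-monoʳ-≤ (2 ^ m) (^-monoʳ-≤ 2 a+y≤m) ⟩
    2 ^ m * 2 ^ m        ≡⟨ ^-distribˡ-+-* 2 m m ⟨
    2 ^ (m + m)          ∎
    where
    a+y≤m : a + y ≤ m
    a+y≤m = ≤-trans (+-monoˡ-≤ y (m≤m+n a N)) (n+n≤2^n y)

  n²<2^L[n] : n ^ 2 < 2 ^ L a n
  n²<2^L[n] = begin-strict
    n ^ 2                <⟨ ^-monoˡ-< 2 n<2^[m+m] ⟩
    (2 ^ (m + m)) ^ 2    ≡⟨ ^-*-assoc 2 (m + m) 2 ⟩
    2 ^ ((m + m) * 2)    ≡⟨ cong (2 ^_) ([m+m]*2≡2^2*m m) ⟩
    2 ^ (2 ^ 2 * m)      ≤⟨ ^-monoʳ-≤ 2 (*-monoˡ-≤ m (^-monoʳ-≤ 2 2≤a)) ⟩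
    2 ^ (2 ^ a * m)      ≤⟨ ^-monoʳ-≤ 2 long-run ⟩
    2 ^ L a n            ∎
    where
    [m+m]*2≡2^2*m : ∀ m → (m + m) * 2 ≡ 2 ^ 2 * m
    [m+m]*2≡2^2*m = solve-∀

mainTheorem5 : ∀ (a : ℕ) → 2 ≤ a → Exceptional (L a)
mainTheorem5 a 2≤a = exceptional-if-frequently-long (L a) (frequently-long-runs a 2≤a)
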